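{- The logic $\mathbf{Six}$ is non-trivial and non-explosive: for any two distinct propositional variables $p,q$, we have $p,\neg p\not\models_{\mathbf{Six}} q$.
   Context: An involutive Stone algebra is a De Morgan algebra (bounded distributive lattice with $\neg\neg x=x$, $\neg(x\wedge y)=\neg x\vee\neg y$) with a unary $\nabla$ satisfying $\nabla0=0$, $a\wedge\nabla a=a$, $\nabla(a\wedge b)=\nabla a\wedge\nabla b$, $\neg\nabla a\wedge\nabla a=0$; the class is $\mathbf S$. $Fm$ is the set of formulas over a denumerable set of propositional variables built from binary $\wedge,\vee$, unary $\neg,\nabla$ and constants $\bot,\top$; homomorphisms send $\bot\mapsto0,\top\mapsto1$. The logic $\mathbf{Six}$: for nonempty finite premises, $\alpha_1,\dots,\alpha_n\models_{\mathbf{Six}}\alpha$ iff for every $A\in\mathbf S$, every homomorphism $v:\mathfrak{Fm}\to A$ and every $a\in A$, if $v(\alpha_i)\ge a$ for all $i$ then $v(\alpha)\ge a$ (empty premises: $v(\alpha)=1$ for all $A,v$; infinite premises: some finite nonempty subset entails $\alpha$). -}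

module Defs where

open import Level using (Level; suc; _⊔_)
open import Data.Nat using (ℕ)
open import Data.List using (List; []; _∷_)
open import Data.List.Relation.Unary.All using (All)
open import Relation.Binary.PropositionalEquality using (_≡_)

record InvStoneAlgebra (c : Level) : Set (suc c) where
  infixr 7 _∧_
  infixr 6 _∨_
  field
    Carrier : Set c
    _∧_ _∨_ : Carrier → Carrier → Carrier
    ¬_ ∇ : Carrier → Carrier
    𝟎 𝟏 : Carrier
    ∧-comm : ∀ x y → x ∧ y ≡ y ∧ x
    ∨-comm : ∀ x y → x ∨ y ≡ y ∨ x
    ∧-assoc : ∀ x y z → (x ∧ y) ∧ z ≡ x ∧ (y ∧ z)
    ∨-assoc : ∀ x y z → (x ∨ y) ∨ z ≡ x ∨ (y ∨ z)
    ∧-absorbs-∨ : ∀ x y → x ∧ (x ∨ y) ≡ x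
    ∨-absorbs-∧ : ∀ x y → x ∨ (x ∧ y) ≡ x
    ∧-distrib-∨ : ∀ x y z → x ∧ (y ∨ z) ≡ (x ∧ y) ∨ (x ∧ z)
    ∧-identity : ∀ x → x ∧ 𝟏 ≡ x
    ∨-identity : ∀ x → x ∨ 𝟎 ≡ x
    ¬-involutive : ∀ x → ¬ (¬ x) ≡ x
    deMorgan : ∀ x y → ¬ (x ∧ y) ≡ (¬ x) ∨ (¬ y)
    ∇-zero : ∇ 𝟎 ≡ 𝟎
    ∇-incr : ∀ a → a ∧ ∇ a ≡ a
    ∇-∧ : ∀ a b → ∇ (a ∧ b) ≡ ∇ a ∧ ∇ b
    ∇-compl : ∀ a → (¬ (∇ a)) ∧ ∇ a ≡ 𝟎

  _≤_ : Carrier → Carrier → Set c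
  a ≤ b = a ∧ b ≡ a

data Fm : Set where
  var : ℕ → Fm
  _∧ᶠ_ _∨ᶠ_ : Fm → Fm → Fm
  ¬ᶠ_ ∇ᶠ_ : Fm → Fm
  ⊥ᶠ ⊤ᶠ : Fm

-- Homomorphisms 𝔉𝔪 → A are exactly the extensions of valuations ℕ → A
⟦_⟧ : ∀ {c} {A : InvStoneAlgebra c} → Fm → (ℕ → InvStoneAlgebra.Carrier A) → InvStoneAlgebra.Carrier A
⟦_⟧ {A = A} (var n) v = v n
⟦_⟧ {A = A} (φ ∧ᶠ ψ) v = InvStoneAlgebra._∧_ A (⟦_⟧ {A = A} φ v) (⟦_⟧ {A = A} ψ v)
⟦_⟧ {A = A} (φ ∨ᶠ ψ) v = InvStoneAlgebra._∨_ A (⟦_⟧ {A = A} φ v) (⟦_⟧ {A = A} ψ v)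
⟦_⟧ {A = A} (¬ᶠ φ) v = InvStoneAlgebra.¬_ A (⟦_⟧ {A = A} φ v)
⟦_⟧ {A = A} (∇ᶠ φ) v = InvStoneAlgebra.∇ A (⟦_⟧ {A = A} φ v)
⟦_⟧ {A = A} ⊥ᶠ v = InvStoneAlgebra.𝟎 A
⟦_⟧ {A = A} ⊤ᶠ v = InvStoneAlgebra.𝟏 A

-- Consequence of Six for a nonempty finite list of premises (α ∷ αs),
-- quantifying over involutive Stone algebras with carriers in universe level c.
SixEntails : (c : Level) → Fm → List Fm → Fm → Set (suc c)
SixEntails c α αs β =
  (A : InvStoneAlgebra c) (v : ℕ → InvStoneAlgebra.Carrier A) (a : InvStoneAlgebra.Carrier A) →
  InvStoneAlgebra._≤_ A a (⟦_⟧ {A = A} α v) →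
  All (λ γ → InvStoneAlgebra._≤_ A a (⟦_⟧ {A = A} γ v)) αs →
  InvStoneAlgebra._≤_ A a (⟦_⟧ {A = A} β v)

{-# OPTIONS --safe #-}
module Submission where

-- The three-element Kleene chain 0 < ½ < 1, with ¬ reversing the order and
-- ∇ sending ½ to 1, is an involutive Stone algebra. Valuing p at ½ and every
-- other variable at 0, the element ½ lies below both p and ¬ p (since ¬ ½ = ½)
-- but not below q.

open import Defs
open import Level using (Level)
open import Data.Nat using (ℕ; _≟_)
open import Data.List using ([]; _∷_)
open import Data.List.Relation.Unary.All using ([]; _∷_)
open import Relation.Nullary using (¬_; yes; no; contradiction)
open import Relation.Binary.PropositionalEquality using (_≡_; _≢_; refl; sym; trans; cong)

data Three {c : Level} : Set c where
  0₃ ½ 1₃ : Three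

module _ {c : Level} where

  infixr 7 _⊓₃_
  infixr 6 _⊔₃_

  _⊓₃_ : Three {c} → Three {c} → Three {c}
  0₃ ⊓₃ y  = 0₃
  ½  ⊓₃ 0₃ = 0₃
  ½  ⊓₃ ½  = ½
  ½  ⊓₃ 1₃ = ½
  1₃ ⊓₃ y  = y

  _⊔₃_ : Three {c} → Three {c} → Three {c}
  0₃ ⊔₃ y  = y
  ½  ⊔₃ 0₃ = ½
  ½  ⊔₃ ½  = ½
  ½  ⊔₃ 1₃ = 1₃
  1₃ ⊔₃ y  = 1₃

  ¬₃_ : Three {c} → Three {c}
  ¬₃ 0₃ = 1₃
  ¬₃ ½  = ½
  ¬₃ 1₃ = 0₃

  ∇₃ : Three {c} → Three {c}
  ∇₃ 0₃ = 0₃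
  ∇₃ ½  = 1₃
  ∇₃ 1₃ = 1₃

  threeStone : InvStoneAlgebra c
  threeStone = record
    { Carrier = Three ; _∧_ = _⊓₃_ ; _∨_ = _⊔₃_ ; ¬_ = ¬₃_ ; ∇ = ∇₃ ; 𝟎 = 0₃ ; 𝟏 = 1₃
    ; ∧-comm = λ { 0₃ 0₃ → refl ; 0₃ ½ → refl ; 0₃ 1₃ → refl ; ½ 0₃ → refl ; ½ ½ → refl
                 ; ½ 1₃ → refl ; 1₃ 0₃ → refl ; 1₃ ½ → refl ; 1₃ 1₃ → refl }
    ; ∨-comm = λ { 0₃ 0₃ → refl ; 0₃ ½ → refl ; 0₃ 1₃ → refl ; ½ 0₃ → refl ; ½ ½ → refl
                 ; ½ 1₃ → refl ; 1₃ 0₃ → refl ; 1₃ ½ → refl ; 1₃ 1₃ → refl }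
    ; ∧-assoc = λ { 0₃ y w → refl ; ½ 0₃ w → refl ; ½ ½ 0₃ → refl ; ½ ½ ½ → refl ; ½ ½ 1₃ → refl
                  ; ½ 1₃ 0₃ → refl ; ½ 1₃ ½ → refl ; ½ 1₃ 1₃ → refl ; 1₃ y w → refl }
    ; ∨-assoc = λ { 0₃ y w → refl ; ½ 0₃ 0₃ → refl ; ½ 0₃ ½ → refl ; ½ 0₃ 1₃ → refl ; ½ ½ 0₃ → refl
                  ; ½ ½ ½ → refl ; ½ ½ 1₃ → refl ; ½ 1₃ w → refl ; 1₃ y w → refl }
    ; ∧-absorbs-∨ = λ { 0₃ y → refl ; ½ 0₃ → refl ; ½ ½ → refl ; ½ 1₃ → refl ; 1₃ y → refl }
    ; ∨-absorbs-∧ = λ { 0₃ y → refl ; ½ 0₃ → refl ; ½ ½ → refl ; ½ 1₃ → refl ; 1₃ y → refl }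
    ; ∧-distrib-∨ = λ { 0₃ y w → refl ; ½ 0₃ 0₃ → refl ; ½ 0₃ ½ → refl ; ½ 0₃ 1₃ → refl
                      ; ½ ½ 0₃ → refl ; ½ ½ ½ → refl ; ½ ½ 1₃ → refl ; ½ 1₃ 0₃ → refl
                      ; ½ 1₃ ½ → refl ; ½ 1₃ 1₃ → refl ; 1₃ y w → refl }
    ; ∧-identity = λ { 0₃ → refl ; ½ → refl ; 1₃ → refl }
    ; ∨-identity = λ { 0₃ → refl ; ½ → refl ; 1₃ → refl }
    ; ¬-involutive = λ { 0₃ → refl ; ½ → refl ; 1₃ → refl }
    ; deMorgan = λ { 0₃ 0₃ → refl ; 0₃ ½ → refl ; 0₃ 1₃ → refl ; ½ 0₃ → refl ; ½ ½ → refl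
                   ; ½ 1₃ → refl ; 1₃ 0₃ → refl ; 1₃ ½ → refl ; 1₃ 1₃ → refl }
    ; ∇-zero = refl
    ; ∇-incr = λ { 0₃ → refl ; ½ → refl ; 1₃ → refl }
    ; ∇-∧ = λ { 0₃ 0₃ → refl ; 0₃ ½ → refl ; 0₃ 1₃ → refl ; ½ 0₃ → refl ; ½ ½ → refl
              ; ½ 1₃ → refl ; 1₃ 0₃ → refl ; 1₃ ½ → refl ; 1₃ 1₃ → refl }
    ; ∇-compl = λ { 0₃ → refl ; ½ → refl ; 1₃ → refl }
    }

module _ {a} {A : Set a} where

  pointValuation : ℕ → A → A → ℕ → A
  pointValuation p x y n with n ≟ p
  ... | yes _ = x
  ... | no _  = y

  pointValuation-at : ∀ p x y → pointValuation p x y p ≡ x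
  pointValuation-at p x y with p ≟ p
  ... | yes _   = refl
  ... | no p≢p  = contradiction refl p≢p

  pointValuation-off : ∀ {p q} x y → p ≢ q → pointValuation p x y q ≡ y
  pointValuation-off {p} {q} x y p≢q with q ≟ p
  ... | yes q≡p = contradiction (sym q≡p) p≢q
  ... | no _    = refl

mainTheorem2 : (c : Level) (p q : ℕ) → p ≢ q →
    ¬ SixEntails c (var p) ((¬ᶠ (var p)) ∷ []) (var q)
mainTheorem2 c p q p≢q entails = ½≰q (entails threeStone v ½ ½≤p (½≤¬p ∷ []))
  where
    v : ℕ → Three {c}
    v = pointValuation p ½ 0₃

    ½≤p : ½ ⊓₃ v p ≡ ½
    ½≤p = cong (½ ⊓₃_) (pointValuation-at p ½ 0₃)

    ½≤¬p : ½ ⊓₃ ¬₃ v p ≡ ½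
    ½≤¬p = cong (λ x → ½ ⊓₃ ¬₃ x) (pointValuation-at p ½ 0₃)

    ½≰q : ¬ (½ ⊓₃ v q ≡ ½)
    ½≰q ½≤q with trans (sym (cong (½ ⊓₃_) (pointValuation-off ½ 0₃ p≢q))) ½≤q
    ... | ()
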